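{- Let $P:[k]^d\to\mathbb{F}_2$ be any $d$-dimensional tensor of rank at most $t$, and let $f_P(x_1,\dots,x_d)=\sum_{(i_1,\dots,i_d)\in[k]^d}P(i_1,\dots,i_d)x_{1,i_1}\cdots x_{d,i_d}$ be its associated $d$-linear form on $(\mathbb{F}_2^k)^d$. Then $$\mathrm{bias}(f_P)\ge\left(1-\frac{2}{2^d}\right)^t.$$
   Context: A tensor $T:[k]^d\to\mathbb{F}_2$ has rank one if $T(i_1,\dots,i_d)=\prod_{j=1}^d u_j(i_j)$ for some vectors $u_1,\dots,u_d\in\mathbb{F}_2^k$; its rank is the minimum number of rank-one tensors summing to it. $\mathrm{bias}(f)=\left|\mathbb{E}_{x_1,\dots,x_d\in\mathbb{F}_2^k}(-1)^{f(x_1,\dots,x_d)}\right|$. -}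

module Defs where

open import Data.Bool using (Bool; true; false; _∧_; _xor_)
open import Data.Nat as ℕ using (ℕ; zero; suc; _≤_)
open import Data.Nat.Properties using (m^n≢0)
open import Data.Fin using (Fin; zero; suc)
open import Data.List using (List; []; _∷_; map; concatMap; foldr)
open import Data.Vec.Functional using () renaming (_∷_ to _∷ᶠ_)
open import Data.Integer as ℤ using (ℤ; +_; -[1+_])
open import Data.Rational as ℚ using (ℚ; 1ℚ; _*_; _-_; _/_)
open import Data.Product using (Σ; ∃; _×_)
open import Relation.Binary.PropositionalEquality using (_≡_)

-- F₂ is represented by Bool: addition = xor, multiplication = ∧.

allFuns : {A : Set} (n : ℕ) → List A → List (Fin n → A)
allFuns zero    as = (λ ()) ∷ []
allFuns (suc n) as = concatMap (λ a → map (a ∷ᶠ_) (allFuns n as)) as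

allFinL : (k : ℕ) → List (Fin k)
allFinL zero    = []
allFinL (suc k) = zero ∷ map suc (allFinL k)

F₂^ : (k : ℕ) → List (Fin k → Bool)
F₂^ k = allFuns k (false ∷ true ∷ [])

⨁ : {n : ℕ} → (Fin n → Bool) → Bool
⨁ {zero}  f = false
⨁ {suc n} f = f zero xor ⨁ (λ i → f (suc i))

⋀ : {n : ℕ} → (Fin n → Bool) → Bool
⋀ {zero}  f = true
⋀ {suc n} f = f zero ∧ ⋀ (λ i → f (suc i))

Tensor : (k d : ℕ) → Set
Tensor k d = (Fin d → Fin k) → Bool

rankOneOf : {k d : ℕ} → (Fin d → Fin k → Bool) → Tensor k d
rankOneOf u i = ⋀ (λ j → u j (i j))

IsRankOne : {k d : ℕ} → Tensor k d → Set
IsRankOne {k} {d} T = Σ (Fin d → Fin k → Bool) λ u → ∀ i → T i ≡ rankOneOf u i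

RankAtMost : {k d : ℕ} → ℕ → Tensor k d → Set
RankAtMost {k} {d} t T =
  Σ ℕ λ r → r ≤ t × Σ (Fin r → Tensor k d) λ Ts →
    (∀ m → IsRankOne (Ts m)) × (∀ i → T i ≡ ⨁ (λ m → Ts m i))

multilinearForm : {k d : ℕ} → Tensor k d → (Fin d → Fin k → Bool) → Bool
multilinearForm {k} {d} P x =
  foldr _xor_ false (map (λ i → P i ∧ ⋀ (λ j → x j (i j))) (allFuns d (allFinL k)))

sign : Bool → ℤ
sign false = + 1
sign true  = -[1+ 0 ]

sumℤ : List ℤ → ℤ
sumℤ = foldr ℤ._+_ (+ 0)

bias : {k d : ℕ} → ((Fin d → Fin k → Bool) → Bool) → ℚ
bias {k} {d} f =
  ℚ.∣ sumℤ (map (λ x → sign (f x)) (allFuns d (F₂^ k))) / (2 ℕ.^ (k ℕ.* d)) ∣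
  where instance _ = m^n≢0 2 (k ℕ.* d)

_^ℚ_ : ℚ → ℕ → ℚ
q ^ℚ zero  = 1ℚ
q ^ℚ suc n = q * (q ^ℚ n)

-- Write f_P = Σ_{m<r} ∏_{j<d} ⟨u_{m,j}, x_j⟩ and, for a mask c ∈ F₂^r, put
-- w_d(0) = 2^d and w_d(1) = 2^d − 2. By induction on d,
--   E_x (−1)^{Σ_m c_m ∏_j ⟨u_{m,j}, x_j⟩} ≥ ∏_m w_d(c_m) / 2^d.
-- Fixing x₁ = a leaves a masked sum of order d − 1 with mask c_m ∧ ⟨u_{m,1}, a⟩, and
-- 2 w_{d−1}(c ∧ s) = w_d(c) + 2c·(−1)^s. Expanding the product over m therefore turns the
-- average over a into a nonnegative combination of character sums Σ_a (−1)^⟨ℓ,a⟩ ∈ {0, 2^k},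
-- whose ℓ = 0 term is 2^k ∏_m w_d(c_m). With c ≡ 1 this gives bias(f_P) ≥ (1 − 2/2^d)^r,
-- and r ≤ t finishes the proof since 0 ≤ 1 − 2/2^d ≤ 1 for d ≥ 1.

module Submission where

open import Defs
open import Algebra.Bundles using (CommutativeMonoid; CommutativeSemiring; CommutativeRing)
open import Data.Bool using (Bool; true; false; _∧_; _xor_)
open import Data.Bool.Properties
  using (xor-∧-commutativeRing; ∧-distribʳ-xor; ∧-assoc; ∧-identityʳ)
open import Data.Nat as ℕ using (ℕ; zero; suc)
import Data.Nat.Properties as ℕP
open import Data.Nat.Properties using (m^n≢0)
open import Data.Fin using (Fin; zero; suc)
open import Data.List using (List; []; _∷_; _++_; map; concatMap; foldr)
open import Data.List.Properties using (map-∘)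
open import Data.Vec.Functional using () renaming (_∷_ to _∷ᶠ_)
open import Data.Product using (_×_; _,_; proj₁; proj₂)
open import Data.Rational as ℚ using (ℚ; 0ℚ; 1ℚ; toℚᵘ)
import Data.Rational.Properties as ℚP
open import Data.Rational.Unnormalised as ℚᵘ using (mkℚᵘ; *≡*; *≤*)
import Data.Rational.Unnormalised.Properties as ℚᵘP
open import Function using (_∘_)
open import Relation.Binary.PropositionalEquality as ≡ using (_≡_; subst; subst₂)

-- sumOver unfolds to exactly the list folds used by multilinearForm and sumℤ in Defs.
module ListSum {c ℓ} (M : CommutativeMonoid c ℓ) where
  open CommutativeMonoid M
  open import Relation.Binary.Reasoning.Setoid setoid
  open import Algebra.Properties.CommutativeSemigroup commutativeSemigroup using (interchange)
  open import Algebra.Properties.CommutativeMonoid.Sum M using (sum)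

  sumOver : {A : Set} → List A → (A → Carrier) → Carrier
  sumOver xs f = foldr _∙_ ε (map f xs)

  sumOver-cong : {A : Set} (xs : List A) {f g : A → Carrier} →
                 (∀ x → f x ≈ g x) → sumOver xs f ≈ sumOver xs g
  sumOver-cong []       f≈g = refl
  sumOver-cong (x ∷ xs) f≈g = ∙-cong (f≈g x) (sumOver-cong xs f≈g)

  sumOver-ε : {A : Set} (xs : List A) → sumOver xs (λ _ → ε) ≈ ε
  sumOver-ε []       = refl
  sumOver-ε (x ∷ xs) = trans (identityˡ _) (sumOver-ε xs)

  sumOver-distrib : {A : Set} (xs : List A) (f g : A → Carrier) →
                    sumOver xs (λ x → f x ∙ g x) ≈ sumOver xs f ∙ sumOver xs g
  sumOver-distrib []       f g = sym (identityˡ ε)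
  sumOver-distrib (x ∷ xs) f g = trans (∙-congˡ (sumOver-distrib xs f g)) (interchange _ _ _ _)

  sumOver-++ : {A : Set} (xs ys : List A) (f : A → Carrier) →
               sumOver (xs ++ ys) f ≈ sumOver xs f ∙ sumOver ys f
  sumOver-++ []       ys f = sym (identityˡ _)
  sumOver-++ (x ∷ xs) ys f = trans (∙-congˡ (sumOver-++ xs ys f)) (sym (assoc _ _ _))

  sumOver-sum-comm : {A : Set} (xs : List A) {r : ℕ} (f : Fin r → A → Carrier) →
                     sumOver xs (λ x → sum (λ m → f m x)) ≈ sum (λ m → sumOver xs (f m))
  sumOver-sum-comm xs {zero}  f = sumOver-ε xs
  sumOver-sum-comm xs {suc r} f = begin
    sumOver xs (λ x → f zero x ∙ sum (λ m → f (suc m) x))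
      ≈⟨ sumOver-distrib xs (f zero) _ ⟩
    sumOver xs (f zero) ∙ sumOver xs (λ x → sum (λ m → f (suc m) x))
      ≈⟨ ∙-congˡ (sumOver-sum-comm xs (f ∘ suc)) ⟩
    sumOver xs (f zero) ∙ sum (λ m → sumOver xs (f (suc m)))
      ∎

  sumOver-map : {A B : Set} (g : A → B) (xs : List A) (f : B → Carrier) →
                sumOver (map g xs) f ≡ sumOver xs (f ∘ g)
  sumOver-map g xs f = ≡.cong (foldr _∙_ ε) (≡.sym (map-∘ xs))

  sumOver-allFinL : {n : ℕ} (f : Fin n → Carrier) → sumOver (allFinL n) f ≈ sum f
  sumOver-allFinL {zero}  f = refl
  sumOver-allFinL {suc n} f =
    ∙-congˡ (trans (reflexive (sumOver-map suc (allFinL n) f)) (sumOver-allFinL (f ∘ suc)))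

  sumOver-concatMap : {A B : Set} (g : A → List B) (xs : List A) (f : B → Carrier) →
                      sumOver (concatMap g xs) f ≈ sumOver xs (λ x → sumOver (g x) f)
  sumOver-concatMap g []       f = refl
  sumOver-concatMap g (x ∷ xs) f =
    trans (sumOver-++ (g x) _ f) (∙-congˡ (sumOver-concatMap g xs f))

  sumOver-allFuns-suc : {A : Set} (n : ℕ) (as : List A) (f : (Fin (suc n) → A) → Carrier) →
    sumOver (allFuns (suc n) as) f ≈ sumOver as (λ a → sumOver (allFuns n as) (f ∘ (a ∷ᶠ_)))
  sumOver-allFuns-suc n as f = trans (sumOver-concatMap _ as f)
    (sumOver-cong as (λ a → reflexive (sumOver-map (a ∷ᶠ_) (allFuns n as) f)))

module SemiringSums {c ℓ} (R : CommutativeSemiring c ℓ) where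
  open CommutativeSemiring R hiding (zero)
  open import Relation.Binary.Reasoning.Setoid setoid
  open import Algebra.Properties.Semiring.Sum semiring public
    using (sum; sum-cong-≗; sum-replicate-zero; ∑-distrib-+; *-distribʳ-sum)
  open import Algebra.Properties.CommutativeMonoid.Sum *-commutativeMonoid public
    using () renaming (sum to ∏; sum-cong-≗ to ∏-cong-≗; ∑-distrib-+ to ∏-distrib-*)
  open ListSum +-commutativeMonoid public

  sumOver-*ˡ : {A : Set} (x : Carrier) (ys : List A) (f : A → Carrier) →
               x * sumOver ys f ≈ sumOver ys (λ y → x * f y)
  sumOver-*ˡ x []       f = zeroʳ x
  sumOver-*ˡ x (y ∷ ys) f = trans (distribˡ x (f y) _) (+-congˡ (sumOver-*ˡ x ys f))

  sumOver-*ʳ : {A : Set} (x : Carrier) (ys : List A) (f : A → Carrier) →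
               sumOver ys f * x ≈ sumOver ys (λ y → f y * x)
  sumOver-*ʳ x []       f = zeroˡ x
  sumOver-*ʳ x (y ∷ ys) f = trans (distribʳ x (f y) _) (+-congˡ (sumOver-*ʳ x ys f))

  sumOver-allFuns-∏ : {A : Set} (n : ℕ) (as : List A) (g : Fin n → A → Carrier) →
    sumOver (allFuns n as) (λ i → ∏ (λ j → g j (i j))) ≈ ∏ (λ j → sumOver as (g j))
  sumOver-allFuns-∏ zero    as g = +-identityʳ 1#
  sumOver-allFuns-∏ (suc n) as g = begin
    sumOver (allFuns (suc n) as) (λ i → ∏ (λ j → g j (i j)))
      ≈⟨ sumOver-allFuns-suc n as _ ⟩
    sumOver as (λ a → sumOver (allFuns n as) (λ i → g zero a * ∏ (λ j → g (suc j) (i j))))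
      ≈⟨ sumOver-cong as (λ a → sym (sumOver-*ˡ (g zero a) (allFuns n as) _)) ⟩
    sumOver as (λ a → g zero a * sumOver (allFuns n as) (λ i → ∏ (λ j → g (suc j) (i j))))
      ≈⟨ sumOver-cong as (λ a → *-congˡ (sumOver-allFuns-∏ n as (g ∘ suc))) ⟩
    sumOver as (λ a → g zero a * ∏ (λ j → sumOver as (g (suc j))))
      ≈⟨ sym (sumOver-*ʳ _ as (g zero)) ⟩
    sumOver as (g zero) * ∏ (λ j → sumOver as (g (suc j)))
      ∎

module F₂ = SemiringSums (CommutativeRing.commutativeSemiring xor-∧-commutativeRing)

open ≡ using (refl; cong; cong₂; sym; trans)
open import Data.Integer as ℤ using (ℤ; +_; 0ℤ; 1ℤ; _+_; _*_; _-_; _≤_; _^_)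
import Data.Integer.Properties as ℤP
open import Data.Integer.Tactic.RingSolver using (solve-∀)
open import Algebra.Properties.CommutativeSemigroup ℤP.*-commutativeSemigroup
  using (x∙yz≈y∙xz; xy∙z≈y∙xz)

⨁≡sum : {n : ℕ} (f : Fin n → Bool) → ⨁ f ≡ F₂.sum f
⨁≡sum {zero}  f = refl
⨁≡sum {suc n} f = cong (f zero xor_) (⨁≡sum (f ∘ suc))

⋀≡∏ : {n : ℕ} (f : Fin n → Bool) → ⋀ f ≡ F₂.∏ f
⋀≡∏ {zero}  f = refl
⋀≡∏ {suc n} f = cong (f zero ∧_) (⋀≡∏ (f ∘ suc))

dot : {k : ℕ} → (Fin k → Bool) → (Fin k → Bool) → Bool
dot v x = F₂.sum (λ i → v i ∧ x i)

rankOneForm : {k d : ℕ} → (Fin d → Fin k → Bool) → (Fin d → Fin k → Bool) → Bool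
rankOneForm u x = F₂.∏ (λ j → dot (u j) (x j))

-- Sums of rank-one forms are not closed under fixing the first argument, masked sums are
-- (see signSum-maskedSum-suc); this is why the induction on d carries a mask.
maskedSum : {k d r : ℕ} → (Fin r → Bool) → (Fin r → Fin d → Fin k → Bool) →
            (Fin d → Fin k → Bool) → Bool
maskedSum c u x = F₂.sum (λ m → c m ∧ rankOneForm (u m) x)

multilinearForm-rankDecomposition : {k d r : ℕ} (P : Tensor k d) (Ts : Fin r → Tensor k d)
  (u : Fin r → Fin d → Fin k → Bool) → (∀ m i → Ts m i ≡ rankOneOf (u m) i) →
  (∀ i → P i ≡ ⨁ (λ m → Ts m i)) → ∀ x → multilinearForm P x ≡ maskedSum (λ _ → true) u x
multilinearForm-rankDecomposition {k} {d} {r} P Ts u Ts≡ P≡ x = begin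
  F₂.sumOver I (λ i → P i ∧ ⋀ (λ j → x j (i j)))
    ≡⟨ F₂.sumOver-cong I (λ i → cong₂ _∧_ (P≡sum i) (⋀≡∏ (X i))) ⟩
  F₂.sumOver I (λ i → F₂.sum (λ m → rankOneOf (u m) i) ∧ F₂.∏ (X i))
    ≡⟨ F₂.sumOver-cong I (λ i → F₂.*-distribʳ-sum (F₂.∏ (X i)) (λ m → rankOneOf (u m) i)) ⟩
  F₂.sumOver I (λ i → F₂.sum (λ m → rankOneOf (u m) i ∧ F₂.∏ (X i)))
    ≡⟨ F₂.sumOver-sum-comm I (λ m i → rankOneOf (u m) i ∧ F₂.∏ (X i)) ⟩
  F₂.sum (λ m → F₂.sumOver I (λ i → rankOneOf (u m) i ∧ F₂.∏ (X i)))
    ≡⟨ F₂.sum-cong-≗ (λ m → F₂.sumOver-cong I (λ i →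
         trans (cong (_∧ F₂.∏ (X i)) (⋀≡∏ (U m i))) (sym (F₂.∏-distrib-* (U m i) (X i))))) ⟩
  F₂.sum (λ m → F₂.sumOver I (λ i → F₂.∏ (λ j → u m j (i j) ∧ x j (i j))))
    ≡⟨ F₂.sum-cong-≗ (λ m → F₂.sumOver-allFuns-∏ d (allFinL k) (λ j a → u m j a ∧ x j a)) ⟩
  F₂.sum (λ m → F₂.∏ (λ j → F₂.sumOver (allFinL k) (λ a → u m j a ∧ x j a)))
    ≡⟨ F₂.sum-cong-≗ (λ m → F₂.∏-cong-≗ (λ j → F₂.sumOver-allFinL (λ a → u m j a ∧ x j a))) ⟩
  F₂.sum (λ m → rankOneForm (u m) x)
    ∎
  where
  open ≡.≡-Reasoning
  I : List (Fin d → Fin k)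
  I = allFuns d (allFinL k)
  X : (Fin d → Fin k) → Fin d → Bool
  X i j = x j (i j)
  U : Fin r → (Fin d → Fin k) → Fin d → Bool
  U m i j = u m j (i j)
  P≡sum : ∀ i → P i ≡ F₂.sum (λ m → rankOneOf (u m) i)
  P≡sum i = trans (P≡ i) (trans (⨁≡sum (λ m → Ts m i)) (F₂.sum-cong-≗ (λ m → Ts≡ m i)))

module ℤΣ = SemiringSums ℤP.+-*-commutativeSemiring

sumOver-mono-≤ : {A : Set} (xs : List A) {f g : A → ℤ} →
                 (∀ x → f x ≤ g x) → ℤΣ.sumOver xs f ≤ ℤΣ.sumOver xs g
sumOver-mono-≤ []       f≤g = ℤP.≤-refl
sumOver-mono-≤ (x ∷ xs) f≤g = ℤP.+-mono-≤ (f≤g x) (sumOver-mono-≤ xs f≤g)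

*-monoˡ-≤-nonNeg′ : {c a b : ℤ} → 0ℤ ≤ c → a ≤ b → c * a ≤ c * b
*-monoˡ-≤-nonNeg′ {c} 0≤c = ℤP.*-monoˡ-≤-nonNeg c {{ℤ.nonNegative 0≤c}}

*-nonNeg : {a b : ℤ} → 0ℤ ≤ a → 0ℤ ≤ b → 0ℤ ≤ a * b
*-nonNeg {a} 0≤a 0≤b =
  ℤP.≤-trans (ℤP.≤-reflexive (sym (ℤP.*-zeroʳ a))) (*-monoˡ-≤-nonNeg′ 0≤a 0≤b)

∏-nonNeg : {r : ℕ} (f : Fin r → ℤ) → (∀ m → 0ℤ ≤ f m) → 0ℤ ≤ ℤΣ.∏ f
∏-nonNeg {zero}  f 0≤f = ℤ.+≤+ ℕ.z≤n
∏-nonNeg {suc r} f 0≤f = *-nonNeg (0≤f zero) (∏-nonNeg (f ∘ suc) (0≤f ∘ suc))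

^-nonNeg : {i : ℤ} (n : ℕ) → 0ℤ ≤ i → 0ℤ ≤ i ^ n
^-nonNeg zero    0≤i = ℤ.+≤+ ℕ.z≤n
^-nonNeg (suc n) 0≤i = *-nonNeg 0≤i (^-nonNeg n 0≤i)

pos-^ : ∀ m n → + (m ℕ.^ n) ≡ (+ m) ^ n
pos-^ m zero    = refl
pos-^ m (suc n) = trans (ℤP.pos-* m (m ℕ.^ n)) (cong (+ m *_) (pos-^ m n))

∏-const : (r : ℕ) (a : ℤ) → ℤΣ.∏ {r} (λ _ → a) ≡ a ^ r
∏-const zero    a = refl
∏-const (suc r) a = cong (a *_) (∏-const r a)

sign-xor : ∀ a b → sign (a xor b) ≡ sign a * sign b
sign-xor false b     = sym (ℤP.*-identityˡ (sign b))
sign-xor true  false = refl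
sign-xor true  true  = refl

sign-sum : {n : ℕ} (f : Fin n → Bool) → sign (F₂.sum f) ≡ ℤΣ.∏ (sign ∘ f)
sign-sum {zero}  f = refl
sign-sum {suc n} f =
  trans (sign-xor (f zero) _) (cong (sign (f zero) *_) (sign-sum (f ∘ suc)))

character : {k : ℕ} → (Fin k → Bool) → (Fin k → Bool) → ℤ
character ℓ a = sign (dot ℓ a)

character-xor : {k : ℕ} (ℓ v a : Fin k → Bool) →
                character (λ i → ℓ i xor v i) a ≡ character ℓ a * character v a
character-xor ℓ v a = trans (cong sign dot-xor) (sign-xor (dot ℓ a) (dot v a))
  where
  dot-xor : dot (λ i → ℓ i xor v i) a ≡ dot ℓ a xor dot v a
  dot-xor = trans (F₂.sum-cong-≗ (λ i → ∧-distribʳ-xor (a i) (ℓ i) (v i)))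
                  (F₂.∑-distrib-+ (λ i → ℓ i ∧ a i) (λ i → v i ∧ a i))

character-zero : {k : ℕ} (a : Fin k → Bool) → character (λ _ → false) a ≡ 1ℤ
character-zero {k} a = cong sign (F₂.sum-replicate-zero k)

characterSum : {k : ℕ} (ℓ : Fin k → Bool) → ℤΣ.sumOver (F₂^ k) (character ℓ)
               ≡ ℤΣ.∏ (λ i → ℤΣ.sumOver (false ∷ true ∷ []) (λ b → sign (ℓ i ∧ b)))
characterSum {k} ℓ =
  trans (ℤΣ.sumOver-cong (F₂^ k) (λ a → sign-sum (λ i → ℓ i ∧ a i)))
        (ℤΣ.sumOver-allFuns-∏ k (false ∷ true ∷ []) (λ i b → sign (ℓ i ∧ b)))

characterSum-nonNeg : {k : ℕ} (ℓ : Fin k → Bool) → 0ℤ ≤ ℤΣ.sumOver (F₂^ k) (character ℓ)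
characterSum-nonNeg ℓ =
  ℤP.≤-trans (∏-nonNeg _ (λ i → factor-nonNeg (ℓ i))) (ℤP.≤-reflexive (sym (characterSum ℓ)))
  where
  factor-nonNeg : ∀ c → 0ℤ ≤ ℤΣ.sumOver (false ∷ true ∷ []) (λ b → sign (c ∧ b))
  factor-nonNeg false = ℤ.+≤+ ℕ.z≤n
  factor-nonNeg true  = ℤ.+≤+ ℕ.z≤n

characterSum-zero : (k : ℕ) → ℤΣ.sumOver (F₂^ k) (character (λ _ → false)) ≡ (+ 2) ^ k
characterSum-zero k = trans (characterSum {k} (λ _ → false)) (∏-const k (+ 2))

characterProductSum : {k r : ℕ} → (Fin k → Bool) → (α β : Fin r → ℤ) →
                      (Fin r → Fin k → Bool) → ℤ
characterProductSum {k} ℓ α β v =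
  ℤΣ.sumOver (F₂^ k) (λ a → character ℓ a * ℤΣ.∏ (λ m → α m + β m * character (v m) a))

characterProductSum-suc : {k r : ℕ} (ℓ : Fin k → Bool) (α β : Fin (suc r) → ℤ)
  (v : Fin (suc r) → Fin k → Bool) →
  characterProductSum ℓ α β v
    ≡ α zero * characterProductSum ℓ (α ∘ suc) (β ∘ suc) (v ∘ suc)
      + β zero * characterProductSum (λ i → ℓ i xor v zero i) (α ∘ suc) (β ∘ suc) (v ∘ suc)
characterProductSum-suc {k} ℓ α β v = begin
  ℤΣ.sumOver (F₂^ k) (λ a → character ℓ a * ((α zero + β zero * character (v zero) a) * rest a))
    ≡⟨ ℤΣ.sumOver-cong (F₂^ k) expand ⟩
  ℤΣ.sumOver (F₂^ k) (λ a → α zero * (character ℓ a * rest a) + β zero * (character ℓ′ a * rest a))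
    ≡⟨ ℤΣ.sumOver-distrib (F₂^ k) _ _ ⟩
  ℤΣ.sumOver (F₂^ k) (λ a → α zero * (character ℓ a * rest a))
    + ℤΣ.sumOver (F₂^ k) (λ a → β zero * (character ℓ′ a * rest a))
    ≡⟨ sym (cong₂ _+_ (ℤΣ.sumOver-*ˡ (α zero) (F₂^ k) _) (ℤΣ.sumOver-*ˡ (β zero) (F₂^ k) _)) ⟩
  α zero * characterProductSum ℓ (α ∘ suc) (β ∘ suc) (v ∘ suc)
    + β zero * characterProductSum ℓ′ (α ∘ suc) (β ∘ suc) (v ∘ suc)
    ∎
  where
  open ≡.≡-Reasoning
  ℓ′ : Fin k → Bool
  ℓ′ i = ℓ i xor v zero i
  rest : (Fin k → Bool) → ℤ
  rest a = ℤΣ.∏ (λ m → α (suc m) + β (suc m) * character (v (suc m)) a)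
  distribute : ∀ x a b y z → x * ((a + b * y) * z) ≡ a * (x * z) + b * ((x * y) * z)
  distribute = solve-∀
  expand : ∀ a → character ℓ a * ((α zero + β zero * character (v zero) a) * rest a)
               ≡ α zero * (character ℓ a * rest a) + β zero * (character ℓ′ a * rest a)
  expand a = trans (distribute (character ℓ a) (α zero) (β zero) (character (v zero) a) (rest a))
    (cong (λ χ → α zero * (character ℓ a * rest a) + β zero * (χ * rest a))
          (sym (character-xor ℓ (v zero) a)))

characterProductSum-nonNeg : {k r : ℕ} (ℓ : Fin k → Bool) (α β : Fin r → ℤ)
  (v : Fin r → Fin k → Bool) → (∀ m → 0ℤ ≤ α m) → (∀ m → 0ℤ ≤ β m) →
  0ℤ ≤ characterProductSum ℓ α β v
characterProductSum-nonNeg {k} {zero} ℓ α β v 0≤α 0≤β =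
  ℤP.≤-trans (characterSum-nonNeg ℓ)
    (ℤP.≤-reflexive (ℤΣ.sumOver-cong (F₂^ k) (λ a → sym (ℤP.*-identityʳ (character ℓ a)))))
characterProductSum-nonNeg {k} {suc r} ℓ α β v 0≤α 0≤β =
  ℤP.≤-trans (ℤP.+-mono-≤ (*-nonNeg (0≤α zero) (tail ℓ))
                          (*-nonNeg (0≤β zero) (tail (λ i → ℓ i xor v zero i))))
             (ℤP.≤-reflexive (sym (characterProductSum-suc ℓ α β v)))
  where
  tail : ∀ ℓ′ → 0ℤ ≤ characterProductSum ℓ′ (α ∘ suc) (β ∘ suc) (v ∘ suc)
  tail ℓ′ = characterProductSum-nonNeg ℓ′ (α ∘ suc) (β ∘ suc) (v ∘ suc)
                                       (0≤α ∘ suc) (0≤β ∘ suc)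

characterProductSum-zero-≥ : {k r : ℕ} (α β : Fin r → ℤ) (v : Fin r → Fin k → Bool) →
  (∀ m → 0ℤ ≤ α m) → (∀ m → 0ℤ ≤ β m) →
  (+ 2) ^ k * ℤΣ.∏ α ≤ characterProductSum (λ _ → false) α β v
characterProductSum-zero-≥ {k} {zero} α β v 0≤α 0≤β = ℤP.≤-reflexive (begin
  (+ 2) ^ k * 1ℤ
    ≡⟨ ℤP.*-identityʳ _ ⟩
  (+ 2) ^ k
    ≡⟨ sym (characterSum-zero k) ⟩
  ℤΣ.sumOver (F₂^ k) (character (λ _ → false))
    ≡⟨ ℤΣ.sumOver-cong (F₂^ k) (λ a → sym (ℤP.*-identityʳ _)) ⟩
  ℤΣ.sumOver (F₂^ k) (λ a → character (λ _ → false) a * 1ℤ)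
    ∎)
  where open ≡.≡-Reasoning
characterProductSum-zero-≥ {k} {suc r} α β v 0≤α 0≤β = begin
  (+ 2) ^ k * (α zero * ℤΣ.∏ (α ∘ suc))
    ≡⟨ x∙yz≈y∙xz ((+ 2) ^ k) (α zero) (ℤΣ.∏ (α ∘ suc)) ⟩
  α zero * ((+ 2) ^ k * ℤΣ.∏ (α ∘ suc))
    ≤⟨ *-monoˡ-≤-nonNeg′ (0≤α zero)
         (characterProductSum-zero-≥ (α ∘ suc) (β ∘ suc) (v ∘ suc) (0≤α ∘ suc) (0≤β ∘ suc)) ⟩
  α zero * tail (λ _ → false)
    ≤⟨ ℤP.i≤i+j _ _ {{ℤ.nonNegative (*-nonNeg (0≤β zero) (tail-nonNeg (v zero)))}} ⟩
  α zero * tail (λ _ → false) + β zero * tail (v zero)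
    ≡⟨ sym (characterProductSum-suc (λ _ → false) α β v) ⟩
  characterProductSum (λ _ → false) α β v
    ∎
  where
  open ℤP.≤-Reasoning
  tail : (Fin k → Bool) → ℤ
  tail ℓ = characterProductSum ℓ (α ∘ suc) (β ∘ suc) (v ∘ suc)
  tail-nonNeg : ∀ ℓ → 0ℤ ≤ tail ℓ
  tail-nonNeg ℓ = characterProductSum-nonNeg ℓ (α ∘ suc) (β ∘ suc) (v ∘ suc) (0≤α ∘ suc) (0≤β ∘ suc)

weight : ℕ → Bool → ℤ
weight d false = (+ 2) ^ d
weight d true  = (+ 2) ^ d - + 2

defect : Bool → ℤ
defect false = 0ℤ
defect true  = + 2

weight-double : ∀ d c s → + 2 * weight d (c ∧ s) ≡ weight (suc d) c + defect c * sign s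
weight-double d false s     = identity ((+ 2) ^ d) (sign s)
  where
  identity : ∀ x y → + 2 * x ≡ + 2 * x + 0ℤ * y
  identity = solve-∀
weight-double d true  false = identity ((+ 2) ^ d)
  where
  identity : ∀ x → + 2 * x ≡ (+ 2 * x - + 2) + + 2 * + 1
  identity = solve-∀
weight-double d true  true  = identity ((+ 2) ^ d)
  where
  identity : ∀ x → + 2 * (x - + 2) ≡ (+ 2 * x - + 2) + + 2 * ℤ.- + 1
  identity = solve-∀

weight-zero : ∀ c → weight 0 c ≡ sign c
weight-zero false = refl
weight-zero true  = refl

2≤2^suc : ∀ d → 2 ℕ.≤ 2 ℕ.^ suc d
2≤2^suc d = ℕP.m≤m*n 2 (2 ℕ.^ d) {{m^n≢0 2 d}}

weight-nonNeg : ∀ d c → 0ℤ ≤ weight (suc d) c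
weight-nonNeg d false = ^-nonNeg (suc d) (ℤ.+≤+ ℕ.z≤n)
weight-nonNeg d true  = ℤP.i≤j⇒0≤j-i (subst (+ 2 ≤_) (pos-^ 2 (suc d)) (ℤ.+≤+ (2≤2^suc d)))

defect-nonNeg : ∀ c → 0ℤ ≤ defect c
defect-nonNeg false = ℤ.+≤+ ℕ.z≤n
defect-nonNeg true  = ℤ.+≤+ ℕ.z≤n

∏-weight-suc-≤ : {k r : ℕ} (d : ℕ) (c : Fin r → Bool) (v : Fin r → Fin k → Bool) →
  (+ 2) ^ k * ℤΣ.∏ (λ m → weight (suc d) (c m))
    ≤ ℤΣ.sumOver (F₂^ k) (λ a → ℤΣ.∏ (λ m → + 2 * weight d (c m ∧ dot (v m) a)))
∏-weight-suc-≤ {k} d c v =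
  ℤP.≤-trans (characterProductSum-zero-≥ (weight (suc d) ∘ c) (defect ∘ c) v
                                          (weight-nonNeg d ∘ c) (defect-nonNeg ∘ c))
             (ℤP.≤-reflexive (ℤΣ.sumOver-cong (F₂^ k) doubled))
  where
  doubled : ∀ a → character (λ _ → false) a
                  * ℤΣ.∏ (λ m → weight (suc d) (c m) + defect (c m) * character (v m) a)
                ≡ ℤΣ.∏ (λ m → + 2 * weight d (c m ∧ dot (v m) a))
  doubled a = trans (cong (_* ∏α+βχ) (character-zero a)) (trans (ℤP.*-identityˡ ∏α+βχ)
                (ℤΣ.∏-cong-≗ (λ m → sym (weight-double d (c m) (dot (v m) a)))))
    where
    ∏α+βχ : ℤ
    ∏α+βχ = ℤΣ.∏ (λ m → weight (suc d) (c m) + defect (c m) * character (v m) a)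

signSum : {k : ℕ} (d : ℕ) → ((Fin d → Fin k → Bool) → Bool) → ℤ
signSum {k} d g = ℤΣ.sumOver (allFuns d (F₂^ k)) (λ x → sign (g x))

signSum-maskedSum-suc : {k d r : ℕ} (c : Fin r → Bool)
  (u : Fin r → Fin (suc d) → Fin k → Bool) →
  signSum (suc d) (maskedSum c u)
    ≡ ℤΣ.sumOver (F₂^ k) (λ a →
        signSum d (maskedSum (λ m → c m ∧ dot (u m zero) a) (λ m → u m ∘ suc)))
signSum-maskedSum-suc {k} {d} c u = trans (ℤΣ.sumOver-allFuns-suc d (F₂^ k) _)
  (ℤΣ.sumOver-cong (F₂^ k) (λ a → ℤΣ.sumOver-cong (allFuns d (F₂^ k)) (λ x →
    cong sign (F₂.sum-cong-≗ (λ m → sym (∧-assoc (c m) _ _))))))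

signSum-maskedSum-zero : {k r : ℕ} (c : Fin r → Bool) (u : Fin r → Fin 0 → Fin k → Bool) →
  signSum 0 (maskedSum c u) ≡ sign (F₂.sum c)
signSum-maskedSum-zero {k} c u = trans
  (ℤΣ.sumOver-cong (allFuns 0 (F₂^ k)) (λ x →
    cong sign (F₂.sum-cong-≗ (λ m → ∧-identityʳ (c m)))))
  (ℤP.+-identityʳ _)

-- Divided by 2^{kd}·(2^d)^r this reads E_x (−1)^{maskedSum c u x} ≥ ∏_m weight d (c m) / 2^d.
signSum-maskedSum-≥ : {k : ℕ} (d : ℕ) {r : ℕ} (c : Fin r → Bool)
  (u : Fin r → Fin d → Fin k → Bool) →
  ((+ 2) ^ k) ^ d * ℤΣ.∏ (λ m → weight d (c m))
    ≤ signSum d (maskedSum c u) * ℤΣ.∏ {r} (λ _ → (+ 2) ^ d)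
signSum-maskedSum-≥ {k} zero {r} c u = ℤP.≤-reflexive (begin
  1ℤ * ℤΣ.∏ (λ m → weight 0 (c m))
    ≡⟨ trans (ℤP.*-identityˡ _) (ℤΣ.∏-cong-≗ (λ m → weight-zero (c m))) ⟩
  ℤΣ.∏ (λ m → sign (c m))
    ≡⟨ sym (sign-sum c) ⟩
  sign (F₂.sum c)
    ≡⟨ sym (signSum-maskedSum-zero c u) ⟩
  signSum 0 (maskedSum c u)
    ≡⟨ sym (ℤP.*-identityʳ _) ⟩
  signSum 0 (maskedSum c u) * 1ℤ
    ≡⟨ cong (signSum 0 (maskedSum c u) *_) (sym (trans (∏-const r 1ℤ) (ℤP.^-zeroˡ r))) ⟩
  signSum 0 (maskedSum c u) * ℤΣ.∏ {r} (λ _ → 1ℤ)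
    ∎)
  where open ≡.≡-Reasoning
signSum-maskedSum-≥ {k} (suc d) {r} c u = begin
  N * N ^ d * W (suc d) c
    ≡⟨ xy∙z≈y∙xz N (N ^ d) (W (suc d) c) ⟩
  N ^ d * (N * W (suc d) c)
    ≤⟨ *-monoˡ-≤-nonNeg′ (^-nonNeg d 0≤N) (∏-weight-suc-≤ d c (λ m → u m zero)) ⟩
  N ^ d * ℤΣ.sumOver (F₂^ k) (λ a → ℤΣ.∏ (λ m → + 2 * weight d (c′ a m)))
    ≡⟨ ℤΣ.sumOver-*ˡ (N ^ d) (F₂^ k) _ ⟩
  ℤΣ.sumOver (F₂^ k) (λ a → N ^ d * ℤΣ.∏ (λ m → + 2 * weight d (c′ a m)))
    ≡⟨ ℤΣ.sumOver-cong (F₂^ k) (λ a →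
         trans (cong (N ^ d *_) (ℤΣ.∏-distrib-* (λ _ → + 2) (λ m → weight d (c′ a m))))
               (x∙yz≈y∙xz (N ^ d) T (W d (c′ a)))) ⟩
  ℤΣ.sumOver (F₂^ k) (λ a → T * (N ^ d * W d (c′ a)))
    ≤⟨ sumOver-mono-≤ (F₂^ k) (λ a →
         *-monoˡ-≤-nonNeg′ 0≤T (signSum-maskedSum-≥ d (c′ a) u′)) ⟩
  ℤΣ.sumOver (F₂^ k) (λ a → T * (S a * P))
    ≡⟨ ℤΣ.sumOver-cong (F₂^ k) (λ a → x∙yz≈y∙xz T (S a) P) ⟩
  ℤΣ.sumOver (F₂^ k) (λ a → S a * (T * P))
    ≡⟨ sym (ℤΣ.sumOver-*ʳ (T * P) (F₂^ k) S) ⟩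
  ℤΣ.sumOver (F₂^ k) S * (T * P)
    ≡⟨ cong₂ _*_ (sym (signSum-maskedSum-suc c u))
                 (sym (ℤΣ.∏-distrib-* {r} (λ _ → + 2) (λ _ → (+ 2) ^ d))) ⟩
  signSum (suc d) (maskedSum c u) * ℤΣ.∏ {r} (λ _ → (+ 2) ^ suc d)
    ∎
  where
  open ℤP.≤-Reasoning
  N : ℤ
  N = (+ 2) ^ k
  0≤N : 0ℤ ≤ N
  0≤N = ^-nonNeg k (ℤ.+≤+ ℕ.z≤n)
  W : (d : ℕ) → (Fin r → Bool) → ℤ
  W d c = ℤΣ.∏ (λ m → weight d (c m))
  c′ : (Fin k → Bool) → Fin r → Bool
  c′ a m = c m ∧ dot (u m zero) a
  u′ : Fin r → Fin d → Fin k → Bool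
  u′ m = u m ∘ suc
  T : ℤ
  T = ℤΣ.∏ {r} (λ _ → + 2)
  0≤T : 0ℤ ≤ T
  0≤T = ∏-nonNeg {r} (λ _ → + 2) (λ _ → ℤ.+≤+ ℕ.z≤n)
  P : ℤ
  P = ℤΣ.∏ {r} (λ _ → (+ 2) ^ d)
  S : (Fin k → Bool) → ℤ
  S a = signSum d (maskedSum (c′ a) u′)

signSum-multilinearForm-≥ : {k d r : ℕ} (P : Tensor k d) (Ts : Fin r → Tensor k d)
  (u : Fin r → Fin d → Fin k → Bool) → (∀ m i → Ts m i ≡ rankOneOf (u m) i) →
  (∀ i → P i ≡ ⨁ (λ m → Ts m i)) →
  (+ (2 ℕ.^ d) - + 2) ^ r * + (2 ℕ.^ (k ℕ.* d)) ≤ signSum d (multilinearForm P) * + ((2 ℕ.^ d) ℕ.^ r)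
signSum-multilinearForm-≥ {k} {d} {r} P Ts u Ts≡ P≡ =
  subst₂ _≤_ lhs rhs (signSum-maskedSum-≥ d (λ _ → true) u)
  where
  open ≡.≡-Reasoning
  lhs : ((+ 2) ^ k) ^ d * ℤΣ.∏ {r} (λ _ → weight d true)
      ≡ (+ (2 ℕ.^ d) - + 2) ^ r * + (2 ℕ.^ (k ℕ.* d))
  lhs = begin
    ((+ 2) ^ k) ^ d * ℤΣ.∏ {r} (λ _ → weight d true)
      ≡⟨ cong₂ _*_ (ℤP.^-*-assoc (+ 2) k d) (∏-const r (weight d true)) ⟩
    (+ 2) ^ (k ℕ.* d) * ((+ 2) ^ d - + 2) ^ r
      ≡⟨ ℤP.*-comm ((+ 2) ^ (k ℕ.* d)) (((+ 2) ^ d - + 2) ^ r) ⟩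
    ((+ 2) ^ d - + 2) ^ r * (+ 2) ^ (k ℕ.* d)
      ≡⟨ sym (cong₂ (λ D N → (D - + 2) ^ r * N) (pos-^ 2 d) (pos-^ 2 (k ℕ.* d))) ⟩
    (+ (2 ℕ.^ d) - + 2) ^ r * + (2 ℕ.^ (k ℕ.* d))
      ∎
  rhs : signSum d (maskedSum (λ _ → true) u) * ℤΣ.∏ {r} (λ _ → (+ 2) ^ d)
      ≡ signSum d (multilinearForm P) * + ((2 ℕ.^ d) ℕ.^ r)
  rhs = cong₂ _*_
    (ℤΣ.sumOver-cong (allFuns d (F₂^ k))
      (λ x → cong sign (sym (multilinearForm-rankDecomposition P Ts u Ts≡ P≡ x))))
    (begin
      ℤΣ.∏ {r} (λ _ → (+ 2) ^ d)  ≡⟨ ∏-const r ((+ 2) ^ d) ⟩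
      ((+ 2) ^ d) ^ r             ≡⟨ cong (_^ r) (sym (pos-^ 2 d)) ⟩
      (+ (2 ℕ.^ d)) ^ r           ≡⟨ sym (pos-^ (2 ℕ.^ d) r) ⟩
      + ((2 ℕ.^ d) ℕ.^ r)         ∎)

toℚᵘ-/ : (i : ℤ) (n : ℕ) .{{_ : ℕ.NonZero n}} → toℚᵘ (i ℚ./ n) ℚᵘ.≃ i ℚᵘ./ n
toℚᵘ-/ i (suc n) = ℚP.toℚᵘ-fromℚᵘ (mkℚᵘ i n)

/-mono-≤ : (i j : ℤ) (m n : ℕ) .{{_ : ℕ.NonZero m}} .{{_ : ℕ.NonZero n}} →
           i * + n ≤ j * + m → i ℚᵘ./ m ℚᵘ.≤ j ℚᵘ./ n
/-mono-≤ i j (suc m) (suc n) = *≤*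

/-*-/ : (i j : ℤ) (m n : ℕ) .{{_ : ℕ.NonZero m}} .{{_ : ℕ.NonZero n}} →
        (i ℚᵘ./ m) ℚᵘ.* (j ℚᵘ./ n) ≡ ((i * j) ℚᵘ./ (m ℕ.* n)) {{ℕP.m*n≢0 m n}}
/-*-/ i j (suc m) (suc n) = refl

toℚᵘ-1-/ : (i : ℤ) (n : ℕ) .{{_ : ℕ.NonZero n}} →
           toℚᵘ (1ℚ ℚ.- i ℚ./ n) ℚᵘ.≃ (+ n - i) ℚᵘ./ n
toℚᵘ-1-/ i (suc n) = ℚᵘP.≃-trans (ℚP.toℚᵘ-homo-+ 1ℚ (ℚ.- (i ℚ./ suc n)))
  (ℚᵘP.≃-trans (ℚᵘP.+-congʳ (toℚᵘ 1ℚ) (ℚᵘP.≃-trans (ℚP.toℚᵘ-homo‿- (i ℚ./ suc n))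
                                                  (ℚᵘP.-‿cong (toℚᵘ-/ i (suc n)))))
  (*≡* (trans (identity (+ suc n) i) (cong (λ m → (+ suc n - i) * + suc m) (sym (ℕP.+-identityʳ n))))))
  where
  identity : ∀ x i → (1ℤ * x + ℤ.- i * 1ℤ) * x ≡ (x - i) * x
  identity = solve-∀

1-/-bounds : (i : ℤ) (n : ℕ) .{{_ : ℕ.NonZero n}} → 0ℤ ≤ i → i ≤ + n →
             0ℚ ℚ.≤ 1ℚ ℚ.- i ℚ./ n × 1ℚ ℚ.- i ℚ./ n ℚ.≤ 1ℚ
1-/-bounds i n 0≤i i≤n =
  ℚP.toℚᵘ-cancel-≤ (ℚᵘP.≤-respʳ-≃ (ℚᵘP.≃-sym (toℚᵘ-1-/ i n))
    (/-mono-≤ 0ℤ (+ n - i) 1 n (subst (0ℤ ≤_) (sym (ℤP.*-identityʳ (+ n - i)))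
                                            (ℤP.i≤j⇒0≤j-i i≤n)))) ,
  ℚP.toℚᵘ-cancel-≤ (ℚᵘP.≤-respˡ-≃ (ℚᵘP.≃-sym (toℚᵘ-1-/ i n))
    (/-mono-≤ (+ n - i) 1ℤ n 1 (subst₂ _≤_ (sym (ℤP.*-identityʳ (+ n - i)))
                                          (sym (ℤP.*-identityˡ (+ n)))
                                          (ℤP.i-j≤i (+ n) i {{ℤ.nonNegative 0≤i}}))))

toℚᵘ-^ℚ : (p : ℚ) (i : ℤ) (n : ℕ) .{{_ : ℕ.NonZero n}} → toℚᵘ p ℚᵘ.≃ i ℚᵘ./ n →
          ∀ t → toℚᵘ (p ^ℚ t) ℚᵘ.≃ ((i ^ t) ℚᵘ./ (n ℕ.^ t)) {{m^n≢0 n t}}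
toℚᵘ-^ℚ p i n p≃i/n zero    = ℚᵘP.≃-refl
toℚᵘ-^ℚ p i n p≃i/n (suc t) = ℚᵘP.≃-trans (ℚP.toℚᵘ-homo-* p (p ^ℚ t))
  (ℚᵘP.≃-trans (ℚᵘP.*-cong p≃i/n (toℚᵘ-^ℚ p i n p≃i/n t))
               (ℚᵘP.≃-reflexive (/-*-/ i (i ^ t) n (n ℕ.^ t) {{_}} {{m^n≢0 n t}})))

^ℚ-≤-/ : (p : ℚ) (a : ℤ) (D : ℕ) .{{_ : ℕ.NonZero D}} → toℚᵘ p ℚᵘ.≃ a ℚᵘ./ D →
         (S : ℤ) (N : ℕ) .{{_ : ℕ.NonZero N}} (r : ℕ) →
         a ^ r * + N ≤ S * + (D ℕ.^ r) → p ^ℚ r ℚ.≤ S ℚ./ N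
^ℚ-≤-/ p a D p≃a/D S N r ineq = ℚP.toℚᵘ-cancel-≤
  (ℚᵘP.≤-respˡ-≃ (ℚᵘP.≃-sym (toℚᵘ-^ℚ p a D p≃a/D r))
  (ℚᵘP.≤-respʳ-≃ (ℚᵘP.≃-sym (toℚᵘ-/ S N))
  (/-mono-≤ (a ^ r) S (D ℕ.^ r) N {{m^n≢0 D r}} ineq)))

^ℚ-nonNeg : {p : ℚ} → 0ℚ ℚ.≤ p → ∀ t → 0ℚ ℚ.≤ p ^ℚ t
^ℚ-nonNeg     0≤p zero    = ℚ.*≤* (ℤ.+≤+ ℕ.z≤n)
^ℚ-nonNeg {p} 0≤p (suc t) = ℚP.≤-trans (ℚP.≤-reflexive (sym (ℚP.*-zeroʳ p)))
                              (ℚP.*-monoˡ-≤-nonNeg p {{ℚ.nonNegative 0≤p}} (^ℚ-nonNeg 0≤p t))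

module _ {p : ℚ} (0≤p : 0ℚ ℚ.≤ p) (p≤1 : p ℚ.≤ 1ℚ) where

  ^ℚ-≤-1 : ∀ t → p ^ℚ t ℚ.≤ 1ℚ
  ^ℚ-≤-1 zero    = ℚP.≤-refl
  ^ℚ-≤-1 (suc t) = ℚP.≤-trans (ℚP.*-monoˡ-≤-nonNeg p {{ℚ.nonNegative 0≤p}} (^ℚ-≤-1 t))
                              (ℚP.≤-trans (ℚP.≤-reflexive (ℚP.*-identityʳ p)) p≤1)

  ^ℚ-antitone : ∀ {r t} → r ℕ.≤ t → p ^ℚ t ℚ.≤ p ^ℚ r
  ^ℚ-antitone {t = t} ℕ.z≤n = ^ℚ-≤-1 t
  ^ℚ-antitone (ℕ.s≤s r≤t)   = ℚP.*-monoˡ-≤-nonNeg p {{ℚ.nonNegative 0≤p}} (^ℚ-antitone r≤t)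

-- For d = 0 the base 1 − 2/2^d of the theorem is −1, while a form with no arguments is constant.
-1^ℚ-≤-1 : ∀ t → (ℚ.- 1ℚ) ^ℚ t ℚ.≤ 1ℚ
-1^ℚ-≤-1 zero          = ℚP.≤-refl
-1^ℚ-≤-1 (suc zero)    = ℚ.*≤* ℤ.-≤+
-1^ℚ-≤-1 (suc (suc t)) = subst (ℚ._≤ 1ℚ) (sym -1*-1*x≡x) (-1^ℚ-≤-1 t)
  where
  x : ℚ
  x = (ℚ.- 1ℚ) ^ℚ t
  -1*-1*x≡x : ℚ.- 1ℚ ℚ.* (ℚ.- 1ℚ ℚ.* x) ≡ x
  -1*-1*x≡x = trans (sym (ℚP.*-assoc (ℚ.- 1ℚ) (ℚ.- 1ℚ) x)) (ℚP.*-identityˡ x)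

bias-nullary : {k : ℕ} (f : (Fin 0 → Fin k → Bool) → Bool) → bias f ≡ 1ℚ
bias-nullary {k} f rewrite ℕP.*-zeroʳ k = ∣sign∣≡1 (f _)
  where
  ∣sign∣≡1 : ∀ b → ℚ.∣ (sign b + 0ℤ) ℚ./ 1 ∣ ≡ 1ℚ
  ∣sign∣≡1 false = refl
  ∣sign∣≡1 true  = refl

theorem4p1 : (k d t : ℕ) (P : Tensor k d) → RankAtMost t P →
    ((1ℚ ℚ.- (+ 2 ℚ./ (2 ℕ.^ d)) {{m^n≢0 2 d}}) ^ℚ t) ℚ.≤ bias (multilinearForm P)
theorem4p1 k zero    t P _ = subst (_ ℚ.≤_) (sym (bias-nullary (multilinearForm P))) (-1^ℚ-≤-1 t)
theorem4p1 k (suc d) t P (r , r≤t , Ts , isRankOne , P≡) = begin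
  q ^ℚ t                     ≤⟨ ^ℚ-antitone 0≤q q≤1 r≤t ⟩
  q ^ℚ r                     ≤⟨ q^r≤S/N ⟩
  S ℚ./ N                    ≡⟨ sym (ℚP.0≤p⇒∣p∣≡p 0≤S/N) ⟩
  bias (multilinearForm P)   ∎
  where
  open ℚP.≤-Reasoning
  D N : ℕ
  D = 2 ℕ.^ suc d
  N = 2 ℕ.^ (k ℕ.* suc d)
  instance
    _ : ℕ.NonZero D
    _ = m^n≢0 2 (suc d)
    _ : ℕ.NonZero N
    _ = m^n≢0 2 (k ℕ.* suc d)
  q : ℚ
  q = 1ℚ ℚ.- + 2 ℚ./ D
  S : ℤ
  S = signSum (suc d) (multilinearForm P)
  bounds : 0ℚ ℚ.≤ q × q ℚ.≤ 1ℚ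
  bounds = 1-/-bounds (+ 2) D (ℤ.+≤+ ℕ.z≤n) (ℤ.+≤+ (2≤2^suc d))
  0≤q : 0ℚ ℚ.≤ q
  0≤q = proj₁ bounds
  q≤1 : q ℚ.≤ 1ℚ
  q≤1 = proj₂ bounds
  q^r≤S/N : q ^ℚ r ℚ.≤ S ℚ./ N
  q^r≤S/N = ^ℚ-≤-/ q (+ D - + 2) D (toℚᵘ-1-/ (+ 2) D) S N r
              (signSum-multilinearForm-≥ P Ts (proj₁ ∘ isRankOne) (proj₂ ∘ isRankOne) P≡)
  0≤S/N : 0ℚ ℚ.≤ S ℚ./ N
  0≤S/N = ℚP.≤-trans (^ℚ-nonNeg 0≤q r) q^r≤S/N
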